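{- Let $n\ge 4$ be an even integer. The honeycomb toroidal graph $\mathrm{HTG}(1,n,3)$ is 2-spanning cyclable if and only if $n \equiv 0 \pmod 4$ and $n > 6$.
   Context: For integers $m\ge 1$, $\ell\ge 0$ and $n\ge 4$ with $n$ even and $m-\ell$ even, the honeycomb toroidal graph $\mathrm{HTG}(m,n,\ell)$ is the simple graph with vertex set $\{u_{i,j}: 0\le i\le m-1,\ 0\le j\le n-1\}$ (first subscript computed modulo $m$, second modulo $n$) whose edge set is the set of the following unordered pairs: $\{u_{i,j},u_{i,j+1}\}$ for all $i,j$ (vertical edges); $\{u_{i,j},u_{i+1,j}\}$ for all $0\le i\le m-2$ with $i+j$ odd (flat edges); and $\{u_{m-1,j},u_{0,j+\ell}\}$ for all $j$ having the same parity as $m$ (and $\ell$) (jump edges). (Repeated pairs give a single edge.) A 2-factor of a graph is a spanning subgraph in which every vertex has valency 2. A graph $X$ is 2-spanning cyclable if for every pair of distinct vertices $u,v$ of $X$ there is a 2-factor of $X$ consisting of exactly two cycles such that $u$ and $v$ lie in different cycles. -}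

module Defs where

open import Data.Nat using (ℕ; zero; suc; _+_; _*_; _∸_; _≤_; _<_)
open import Data.Nat.Divisibility using (_∣_)
open import Data.Fin using (Fin; toℕ)
open import Data.Product using (_×_; _,_; ∃-syntax; proj₁; proj₂)
open import Data.Sum using (_⊎_)
open import Data.List using (List; []; _∷_; length)
open import Data.List.Membership.Propositional using (_∈_)
open import Data.List.Relation.Unary.Unique.Propositional using (Unique)
open import Relation.Binary.PropositionalEquality using (_≡_)
open import Relation.Nullary using (¬_)
open import Data.Empty using (⊥)

CongMod : ℕ → ℕ → ℕ → Set
CongMod n a b = ∃[ k ] (a ≡ b + k * n ⊎ b ≡ a + k * n)

-- vertex u_{i,j} of HTG(m,n,ℓ) is (i , j)
Vertex : ℕ → ℕ → Set
Vertex m n = Fin m × Fin n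

-- the directed versions of the three edge kinds; an edge {x,y} is present
-- iff one of them holds for (x,y) or for (y,x)

VertEdge : (m n : ℕ) → Vertex m n → Vertex m n → Set
VertEdge m n (i , j) (i' , j') = toℕ i ≡ toℕ i' × CongMod n (toℕ j') (toℕ j + 1)

FlatEdge : (m n : ℕ) → Vertex m n → Vertex m n → Set
FlatEdge m n (i , j) (i' , j') =
  toℕ i' ≡ suc (toℕ i) × toℕ j' ≡ toℕ j × ¬ (2 ∣ (toℕ i + toℕ j))

JumpEdge : (m n ℓ : ℕ) → Vertex m n → Vertex m n → Set
JumpEdge m n ℓ (i , j) (i' , j') =
  toℕ i ≡ m ∸ 1 × toℕ i' ≡ 0 × CongMod 2 (toℕ j) m × CongMod n (toℕ j') (toℕ j + ℓ)

EdgeDir : (m n ℓ : ℕ) → Vertex m n → Vertex m n → Set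
EdgeDir m n ℓ x y = VertEdge m n x y ⊎ FlatEdge m n x y ⊎ JumpEdge m n ℓ x y

Adj : (m n ℓ : ℕ) → Vertex m n → Vertex m n → Set
Adj m n ℓ x y = ¬ (x ≡ y) × (EdgeDir m n ℓ x y ⊎ EdgeDir m n ℓ y x)

module _ {V : Set} (A : V → V → Set) where
  ChainTo : V → V → List V → Set
  ChainTo first prev []       = A prev first
  ChainTo first prev (x ∷ xs) = A prev x × ChainTo first x xs

  IsCycle : List V → Set
  IsCycle []       = ⊥
  IsCycle (x ∷ xs) = 3 ≤ length (x ∷ xs) × Unique (x ∷ xs) × ChainTo x x xs

-- a 2-factor of X consisting of exactly two cycles C₁, C₂ : vertex-disjoint
-- cycles whose union is the whole vertex set (the 2-factor's edge set is
-- the union of the edge sets of the two cycles)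
TwoCycleFactor : (m n ℓ : ℕ) → List (Vertex m n) → List (Vertex m n) → Set
TwoCycleFactor m n ℓ C₁ C₂ =
  IsCycle (Adj m n ℓ) C₁ × IsCycle (Adj m n ℓ) C₂ ×
  (∀ v → ¬ (v ∈ C₁ × v ∈ C₂)) × (∀ v → v ∈ C₁ ⊎ v ∈ C₂)

TwoSpanningCyclable : (m n ℓ : ℕ) → Set
TwoSpanningCyclable m n ℓ =
  (u v : Vertex m n) → ¬ (u ≡ v) →
  ∃[ C₁ ] ∃[ C₂ ] (TwoCycleFactor m n ℓ C₁ C₂ × u ∈ C₁ × v ∈ C₂)

module Submission where

-- HTG(1,n,3) is the cycle 0, 1, …, n−1 together with the chords j — j+3 for odd j. It is
-- cubic, and its rungs {2k+1, 2k+2} form a ladder in which consecutive rungs are joined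
-- crosswise: a prism when 4 ∣ n and a Möbius ladder when n ≡ 2 (mod 4).
--
-- Necessity. On a cycle of a 2-factor of a cubic graph, a vertex with one neighbour off its
-- cycle has its other two neighbours on it. So if 1 ∈ C₁ and 2 ∈ C₂, then 3 ∈ C₂ and
-- 4 ∈ C₁, then 5 ∈ C₁ and 6 ∈ C₂, and so on around the ladder; when n ≡ 2 (mod 4) this
-- returns with n + 1 ≡ 1 in C₂. When n = 4 the vertex 1 has only the neighbours 0 and 2.
--
-- Sufficiency (n = 8 + 4p). The two rails (residues {0,1} and {2,3} mod 4) form a 2-factor,
-- and so do the 4-cycle n−1, 0, 1, 2 and the cycle through the remaining vertices. Every even
-- shift j ↦ j + d is an automorphism, so it suffices to separate 0 or 1 from any other vertex:
-- all vertices are separated from them by one of the two factors, except for the pair {0, 1},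
-- which is the image of {2, 3} under the shift by n − 2.

open import Defs
open import Data.Nat using (ℕ; zero; suc; pred; _+_; _*_; _∸_; _≤_; _<_; _>_; s≤s; z≤n; NonZero)
open import Data.Nat.Properties
open import Data.Nat.DivMod
open import Data.Nat.Divisibility using (_∣_; divides; divides-refl; n∣m⇒m%n≡0; ∣n⇒∣m*n; ∣m∣n⇒∣m+n; ∣m+n∣m⇒∣n; *-cancelʳ-∣)
open import Data.Nat.Tactic.RingSolver using (solve-∀)
open import Data.Fin using (toℕ; fromℕ<) renaming (zero to fzero)
open import Data.Fin.Properties using (toℕ-fromℕ<; toℕ-injective; toℕ<n)
open import Data.Product using (_×_; _,_; ∃-syntax; ∃₂; proj₁; proj₂)
open import Data.Sum using (_⊎_; inj₁; inj₂; [_,_]′)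
open import Data.Empty using (⊥-elim)
open import Data.List using (List; []; _∷_; _++_; [_]; length; map)
open import Data.List.Properties using (length-++; ++-assoc; ++-identityʳ; length-map)
open import Data.List.Membership.Propositional using (_∈_; _∉_)
open import Data.List.Membership.Propositional.Properties using (∈-map⁺; ∈-map⁻; ∈-++⁻; ∈-++⁺ˡ; ∈-++⁺ʳ)
open import Data.List.Relation.Binary.Subset.Propositional using (_⊆_)
open import Data.List.Relation.Unary.Any using (here; there)
import Data.List.Relation.Unary.All as All
import Data.List.Relation.Unary.All.Properties as All
open import Data.List.Relation.Unary.AllPairs using ([]; _∷_)
import Data.List.Relation.Unary.AllPairs as AllPairs
open import Data.List.Relation.Unary.Linked using (Linked; []; [-]; _∷_)
open import Data.List.Relation.Unary.Linked.Properties using (Linked⇒AllPairs)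
open import Data.List.Relation.Unary.Unique.Propositional using (Unique)
import Data.List.Relation.Unary.Unique.Propositional.Properties as Unique
open import Relation.Binary.PropositionalEquality using (_≡_; refl; sym; trans; cong; cong₂; subst; subst₂; module ≡-Reasoning)
open import Relation.Nullary using (¬_)
open import Function.Bundles using (_⇔_; mk⇔)
open import Function using (_∘_)

module _ {d : ℕ} .{{_ : NonZero d}} where

  CongMod⇒%≡ : ∀ {a b} → CongMod d a b → a % d ≡ b % d
  CongMod⇒%≡ {a} {b} (k , inj₁ a≡b+kd) = trans (cong (_% d) a≡b+kd) ([m+kn]%n≡m%n b k d)
  CongMod⇒%≡ {a} {b} (k , inj₂ b≡a+kd) = sym (trans (cong (_% d) b≡a+kd) ([m+kn]%n≡m%n a k d))

  %≡∧/≤⇒≡+* : ∀ {a b} → a % d ≡ b % d → a / d ≤ b / d → b ≡ a + (b / d ∸ a / d) * d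
  %≡∧/≤⇒≡+* {a} {b} a≡b a/d≤b/d = begin
    b                                ≡⟨ m≡m%n+[m/n]*n b d ⟩
    b % d + b / d * d                ≡⟨ cong₂ _+_ (sym a≡b) (cong (_* d) (sym (m+[n∸m]≡n a/d≤b/d))) ⟩
    a % d + (a / d + t) * d          ≡⟨ cong (a % d +_) (*-distribʳ-+ d (a / d) t) ⟩
    a % d + (a / d * d + t * d)      ≡⟨ sym (+-assoc (a % d) _ _) ⟩
    a % d + a / d * d + t * d        ≡⟨ cong (_+ t * d) (sym (m≡m%n+[m/n]*n a d)) ⟩
    a + t * d                        ∎
    where
    open ≡-Reasoning
    t = b / d ∸ a / d

  %≡⇒CongMod : ∀ {a b} → a % d ≡ b % d → CongMod d a b
  %≡⇒CongMod {a} {b} a≡b with ≤-total (a / d) (b / d)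
  ... | inj₁ ≤ = b / d ∸ a / d , inj₂ (%≡∧/≤⇒≡+* a≡b ≤)
  ... | inj₂ ≥ = a / d ∸ b / d , inj₁ (%≡∧/≤⇒≡+* (sym a≡b) ≥)

+-right-comm : ∀ a b c → a + b + c ≡ a + c + b
+-right-comm = solve-∀

chainTo-++ : ∀ {V : Set} {A : V → V → Set} {f y p} xs ys → ChainTo A y p xs → ChainTo A f y ys → ChainTo A f p (xs ++ y ∷ ys)
chainTo-++ []       ys py        ch = py , ch
chainTo-++ (x ∷ xs) ys (px , ch₁) ch₂ = px , chainTo-++ xs ys ch₁ ch₂

module Cycles {V : Set} (A : V → V → Set) (A-sym : ∀ {x y} → A x y → A y x) where

  HasTwoNeighboursIn : List V → V → Set
  HasTwoNeighboursIn C w = ∃₂ λ p q → ¬ p ≡ q × A w p × A w q × p ∈ C × q ∈ C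

  hasTwoNeighbours-⊆ : ∀ {C C′ w} → C ⊆ C′ → HasTwoNeighboursIn C w → HasTwoNeighboursIn C′ w
  hasTwoNeighbours-⊆ C⊆C′ (p , q , p≢q , wp , wq , p∈ , q∈) = p , q , p≢q , wp , wq , C⊆C′ p∈ , C⊆C′ q∈

  chainTo-last : ∀ {f p} z zs → ChainTo A f p (z ∷ zs) → ∃[ l ] (l ∈ z ∷ zs × A l f)
  chainTo-last z []         (_ , lf) = z , here refl , lf
  chainTo-last z (z′ ∷ zs) (_ , ch) with chainTo-last z′ zs ch
  ... | l , l∈ , lf = l , there l∈ , lf

  head-hasTwoNeighbours : ∀ {x zs} → IsCycle A (x ∷ zs) → HasTwoNeighboursIn (x ∷ zs) x
  head-hasTwoNeighbours {zs = []}         (s≤s () , _)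
  head-hasTwoNeighbours {zs = _ ∷ []}     (s≤s (s≤s ()) , _)
  head-hasTwoNeighbours {zs = y ∷ z ∷ zs} (_ , (_ ∷ y∉ ∷ _) , xy , ch) with chainTo-last z zs ch
  ... | l , l∈ , lx = y , l , All.lookup y∉ l∈ , xy , A-sym lx , there (here refl) , there (there l∈)

  rotate : ∀ {x y zs} → IsCycle A (x ∷ y ∷ zs) → IsCycle A (y ∷ zs ++ [ x ])
  rotate {x} {y} {zs} (3≤ , x∉ ∷ u , xy , ch) =
    subst (λ k → 3 ≤ suc k) (sym (trans (length-++ zs) (+-comm (length zs) 1))) 3≤ ,
    Unique.++⁺ u (All.[] ∷ []) (λ { (v∈zs , here refl) → All.lookup x∉ v∈zs refl }) ,
    chainTo-++ zs [] ch xy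

  rotate-⊆ : ∀ {x y : V} {zs} → y ∷ zs ++ [ x ] ⊆ x ∷ y ∷ zs
  rotate-⊆ (here refl) = there (here refl)
  rotate-⊆ {zs = zs} (there v∈) with ∈-++⁻ zs v∈
  ... | inj₁ v∈zs        = there (there v∈zs)
  ... | inj₂ (here refl) = here refl

  private
    hasTwoNeighbours-++ : ∀ {w} x L R → IsCycle A (x ∷ L ++ R) → w ∈ L → HasTwoNeighboursIn (x ∷ L ++ R) w
    hasTwoNeighbours-++ x (y ∷ L) R cyc (here refl) =
      hasTwoNeighbours-⊆ rotate-⊆ (head-hasTwoNeighbours (rotate cyc))
    hasTwoNeighbours-++ x (y ∷ L) R cyc (there w∈L) =
      hasTwoNeighbours-⊆ (λ v∈ → rotate-⊆ (subst (λ t → _ ∈ y ∷ t) (sym (++-assoc L R [ x ])) v∈))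
        (hasTwoNeighbours-++ y L (R ++ [ x ]) (subst (λ t → IsCycle A (y ∷ t)) (++-assoc L R [ x ]) (rotate cyc)) w∈L)

  cycle-hasTwoNeighbours : ∀ {C w} → IsCycle A C → w ∈ C → HasTwoNeighboursIn C w
  cycle-hasTwoNeighbours {x ∷ zs} cyc (here refl) = head-hasTwoNeighbours cyc
  cycle-hasTwoNeighbours {x ∷ zs} {w} cyc (there w∈) =
    subst (λ t → HasTwoNeighboursIn (x ∷ t) w) (++-identityʳ zs)
      (hasTwoNeighbours-++ x zs [] (subst (λ t → IsCycle A (x ∷ t)) (sym (++-identityʳ zs)) cyc) w∈)

  cycle-forced : ∀ {C x a b c} → IsCycle A C → x ∈ C → (∀ w → A x w → w ≡ a ⊎ w ≡ b ⊎ w ≡ c) →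
                 a ∉ C → b ∈ C × c ∈ C × ¬ b ≡ c
  cycle-forced cyc x∈ nbrs a∉ with cycle-hasTwoNeighbours cyc x∈
  ... | p , q , p≢q , xp , xq , p∈ , q∈ with nbrs p xp | nbrs q xq
  ... | inj₁ refl          | _                = ⊥-elim (a∉ p∈)
  ... | _                  | inj₁ refl        = ⊥-elim (a∉ q∈)
  ... | inj₂ (inj₁ refl) | inj₂ (inj₁ refl) = ⊥-elim (p≢q refl)
  ... | inj₂ (inj₂ refl) | inj₂ (inj₂ refl) = ⊥-elim (p≢q refl)
  ... | inj₂ (inj₁ refl) | inj₂ (inj₂ refl) = p∈ , q∈ , p≢q
  ... | inj₂ (inj₂ refl) | inj₂ (inj₁ refl) = q∈ , p∈ , p≢q ∘ sym

IsTwoCycleFactor : {V : Set} → (V → V → Set) → List V → List V → Set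
IsTwoCycleFactor A C₁ C₂ =
  IsCycle A C₁ × IsCycle A C₂ × (∀ v → ¬ (v ∈ C₁ × v ∈ C₂)) × (∀ v → v ∈ C₁ ⊎ v ∈ C₂)

Separated : {V : Set} → (V → V → Set) → V → V → Set
Separated A u v = ∃₂ λ C₁ C₂ → IsTwoCycleFactor A C₁ C₂ × u ∈ C₁ × v ∈ C₂

module _ {V : Set} {A : V → V → Set} where

  separated-sym : ∀ {u v} → Separated A u v → Separated A v u
  separated-sym (C₁ , C₂ , (cyc₁ , cyc₂ , disj , cover) , u∈ , v∈) =
    C₂ , C₁ , (cyc₂ , cyc₁ , (λ w (w∈₂ , w∈₁) → disj w (w∈₁ , w∈₂)) , [ inj₂ , inj₁ ]′ ∘ cover) , v∈ , u∈

module _ {U V : Set} {A : U → U → Set} {B : V → V → Set}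
         (f : U → V) (f-hom : ∀ {x y} → A x y → B (f x) (f y)) where

  InjectiveOn : (U → Set) → Set
  InjectiveOn P = ∀ {x y} → P x → P y → f x ≡ f y → x ≡ y

  chainTo-map : ∀ {a b} zs → ChainTo A a b zs → ChainTo B (f a) (f b) (map f zs)
  chainTo-map []       ba        = f-hom ba
  chainTo-map (z ∷ zs) (bz , ch) = f-hom bz , chainTo-map zs ch

  unique-map : ∀ {C} → InjectiveOn (_∈ C) → Unique C → Unique (map f C)
  unique-map {[]}    inj []        = []
  unique-map {x ∷ C} inj (x∉ ∷ u) =
    All.map⁺ (All.tabulate λ y∈ fx≡fy → All.lookup x∉ y∈ (inj (here refl) (there y∈) fx≡fy)) ∷
    unique-map (λ x∈ y∈ → inj (there x∈) (there y∈)) u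

  isCycle-map : ∀ {C} → InjectiveOn (_∈ C) → IsCycle A C → IsCycle B (map f C)
  isCycle-map {x ∷ zs} inj (3≤ , u , ch) =
    subst (3 ≤_) (sym (length-map f (x ∷ zs))) 3≤ , unique-map inj u , chainTo-map zs ch

  isTwoCycleFactor-map : ∀ {C₁ C₂} → IsCycle A C₁ → IsCycle A C₂ →
    InjectiveOn (λ x → x ∈ C₁ ⊎ x ∈ C₂) → (∀ x → ¬ (x ∈ C₁ × x ∈ C₂)) →
    (∀ v → ∃[ x ] (f x ≡ v × (x ∈ C₁ ⊎ x ∈ C₂))) →
    IsTwoCycleFactor B (map f C₁) (map f C₂)
  isTwoCycleFactor-map {C₁} {C₂} cyc₁ cyc₂ inj disj onto =
    isCycle-map (λ x∈ y∈ → inj (inj₁ x∈) (inj₁ y∈)) cyc₁ ,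
    isCycle-map (λ x∈ y∈ → inj (inj₂ x∈) (inj₂ y∈)) cyc₂ ,
    disj′ , cover
    where
    disj′ : ∀ v → ¬ (v ∈ map f C₁ × v ∈ map f C₂)
    disj′ v (v∈₁ , v∈₂) with ∈-map⁻ f v∈₁ | ∈-map⁻ f v∈₂
    ... | x , x∈ , refl | y , y∈ , v≡fy =
      disj x (x∈ , subst (_∈ C₂) (sym (inj (inj₁ x∈) (inj₂ y∈) v≡fy)) y∈)
    cover : ∀ v → v ∈ map f C₁ ⊎ v ∈ map f C₂
    cover v with onto v
    ... | x , refl , inj₁ x∈ = inj₁ (∈-map⁺ f x∈)
    ... | x , refl , inj₂ x∈ = inj₂ (∈-map⁺ f x∈)

module _ {V : Set} {A : V → V → Set} (f g : V → V)
         (f-hom : ∀ {x y} → A x y → A (f x) (f y))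
         (g∘f : ∀ x → g (f x) ≡ x) (f∘g : ∀ x → f (g x) ≡ x) where

  separated-image : ∀ {u v} → Separated A u v → Separated A (f u) (f v)
  separated-image (C₁ , C₂ , (cyc₁ , cyc₂ , disj , cover) , u∈ , v∈) =
    map f C₁ , map f C₂ ,
    isTwoCycleFactor-map f f-hom cyc₁ cyc₂ (λ _ _ → injective) disj (λ v → g v , f∘g v , cover (g v)) ,
    ∈-map⁺ f u∈ , ∈-map⁺ f v∈
    where
    injective : ∀ {x y} → f x ≡ f y → x ≡ y
    injective {x} {y} fx≡fy = trans (sym (g∘f x)) (trans (cong g fx≡fy) (g∘f y))

Adj-sym : ∀ {m n ℓ} {x y : Vertex m n} → Adj m n ℓ x y → Adj m n ℓ y x
Adj-sym (x≢y , inj₁ xy) = x≢y ∘ sym , inj₂ xy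
Adj-sym (x≢y , inj₂ yx) = x≢y ∘ sym , inj₁ yx

rail : ℕ → ℕ → ℕ → List ℕ
rail c j zero    = []
rail c j (suc k) = c + j * 4 ∷ suc (c + j * 4) ∷ rail c (suc j) k

descent : ℕ → List ℕ
descent zero    = [ 3 ]
descent (suc i) = 3 + suc i * 4 ∷ 2 + suc i * 4 ∷ descent i

rail-next : ∀ c j → 3 + suc (c + j * 4) ≡ c + suc j * 4
rail-next = solve-∀

block-mono-≤ : ∀ {r s i j} → r ≤ s → i ≤ j → r + i * 4 ≤ s + j * 4
block-mono-≤ r≤s i≤j = +-mono-≤ r≤s (*-monoˡ-≤ 4 i≤j)

∈-rail⁻ : ∀ {c x} j k → x ∈ rail c j k → ∃[ i ] (j ≤ i × i < j + k × (x ≡ c + i * 4 ⊎ x ≡ suc (c + i * 4)))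
∈-rail⁻ j (suc k) (here refl)         = j , ≤-refl , m<m+n j (s≤s z≤n) , inj₁ refl
∈-rail⁻ j (suc k) (there (here refl)) = j , ≤-refl , m<m+n j (s≤s z≤n) , inj₂ refl
∈-rail⁻ j (suc k) (there (there x∈)) with ∈-rail⁻ (suc j) k x∈
... | i , j<i , i<j+1+k , x≡ = i , <⇒≤ j<i , subst (i <_) (sym (+-suc j k)) i<j+1+k , x≡

∈-rail⁺ : ∀ {c} j k {i} → j ≤ i → i < j + k → c + i * 4 ∈ rail c j k × suc (c + i * 4) ∈ rail c j k
∈-rail⁺ j zero    j≤i i<j+0 = ⊥-elim (<⇒≱ i<j+0 (subst (_≤ _) (sym (+-identityʳ j)) j≤i))
∈-rail⁺ j (suc k) {i} j≤i i<j+1+k with m≤n⇒m<n∨m≡n j≤i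
... | inj₂ refl = here refl , there (here refl)
... | inj₁ j<i with ∈-rail⁺ (suc j) k j<i (subst (i <_) (+-suc j k) i<j+1+k)
...   | x∈ , sx∈ = there (there x∈) , there (there sx∈)

∈-descent⁻ : ∀ {x} p → x ∈ descent p → ∃[ i ] ((i ≤ p × x ≡ 3 + i * 4) ⊎ (i < p × x ≡ 6 + i * 4))
∈-descent⁻ zero    (here refl)         = 0 , inj₁ (z≤n , refl)
∈-descent⁻ (suc p) (here refl)         = suc p , inj₁ (≤-refl , refl)
∈-descent⁻ (suc p) (there (here refl)) = p , inj₂ (≤-refl , refl)
∈-descent⁻ (suc p) (there (there x∈)) with ∈-descent⁻ p x∈
... | i , inj₁ (i≤p , x≡) = i , inj₁ (m≤n⇒m≤1+n i≤p , x≡)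
... | i , inj₂ (i<p , x≡) = i , inj₂ (m<n⇒m<1+n i<p , x≡)

3+i*4∈descent : ∀ p {i} → i ≤ p → 3 + i * 4 ∈ descent p
3+i*4∈descent zero    z≤n = here refl
3+i*4∈descent (suc p) i≤1+p with m≤n⇒m<n∨m≡n i≤1+p
... | inj₂ refl       = here refl
... | inj₁ (s≤s i≤p) = there (there (3+i*4∈descent p i≤p))

6+i*4∈descent : ∀ p {i} → i < p → 6 + i * 4 ∈ descent p
6+i*4∈descent (suc p) (s≤s i≤p) with m≤n⇒m<n∨m≡n i≤p
... | inj₂ refl = there (here refl)
... | inj₁ i<p  = there (there (6+i*4∈descent p i<p))

rail-increasing : ∀ c j k → Linked _<_ (rail c j k)
∷-rail-increasing : ∀ {c x} j k → x < c + j * 4 → Linked _<_ (x ∷ rail c j k)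

∷-rail-increasing j zero    x< = [-]
∷-rail-increasing {c} j (suc k) x< = x< ∷ rail-increasing c j (suc k)

rail-increasing c j zero    = []
rail-increasing c j (suc k) =
  n<1+n _ ∷ ∷-rail-increasing (suc j) k (subst (suc (c + j * 4) <_) (rail-next c j) (m<n+m (suc (c + j * 4)) {3} (s≤s z≤n)))

∷-descent-decreasing : ∀ {x} i → 3 + i * 4 < x → Linked _>_ (x ∷ descent i)
∷-descent-decreasing zero    x> = x> ∷ [-]
∷-descent-decreasing (suc i) x> =
  x> ∷ n<1+n _ ∷ ∷-descent-decreasing i (+-monoˡ-< (i * 4) {3} {6} (s≤s (s≤s (s≤s (s≤s z≤n)))))

increasing⇒unique : ∀ {xs} → Linked _<_ xs → Unique xs
increasing⇒unique = AllPairs.map <⇒≢ ∘ Linked⇒AllPairs <-trans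

decreasing⇒unique : ∀ {xs} → Linked _>_ xs → Unique xs
decreasing⇒unique = AllPairs.map (λ y<x → <⇒≢ y<x ∘ sym) ∘ Linked⇒AllPairs (λ x>y y>z → <-trans y>z x>y)

rail₀-residue : ∀ {x} j k → x ∈ rail 0 j k → x % 4 ≤ 1
rail₀-residue j k x∈ with ∈-rail⁻ j k x∈
... | i , _ , _ , inj₁ refl = subst (_≤ 1) (sym ([m+kn]%n≡m%n 0 i 4)) z≤n
... | i , _ , _ , inj₂ refl = ≤-reflexive ([m+kn]%n≡m%n 1 i 4)

rail₂-residue : ∀ {x} j k → x ∈ rail 2 j k → 2 ≤ x % 4
rail₂-residue j k x∈ with ∈-rail⁻ j k x∈
... | i , _ , _ , inj₁ refl = ≤-reflexive (sym ([m+kn]%n≡m%n 2 i 4))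
... | i , _ , _ , inj₂ refl = subst (2 ≤_) (sym ([m+kn]%n≡m%n 3 i 4)) (n≤1+n 2)

descent-residue : ∀ {x} p → x ∈ descent p → 2 ≤ x % 4
descent-residue p x∈ with ∈-descent⁻ p x∈
... | i , inj₁ (_ , refl) = subst (2 ≤_) (sym ([m+kn]%n≡m%n 3 i 4)) (n≤1+n 2)
... | i , inj₂ (_ , refl) = ≤-reflexive (sym ([m+kn]%n≡m%n 6 i 4))

rail-< : ∀ {c x} j k → c ≤ 2 → x ∈ rail c j k → x < (j + k) * 4
rail-< {c} j k c≤2 x∈ with ∈-rail⁻ j k x∈
... | i , _ , i<j+k , x≡ = ≤-<-trans (x≤ x≡) (<-≤-trans (block-mono-≤ {i = i} (s≤s (s≤s c≤2)) ≤-refl) (*-monoˡ-≤ 4 i<j+k))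
  where
  x≤ : ∀ {x} → x ≡ c + i * 4 ⊎ x ≡ suc (c + i * 4) → x ≤ suc (c + i * 4)
  x≤ (inj₁ refl) = n≤1+n _
  x≤ (inj₂ refl) = ≤-refl

by-blocks : ∀ {m} (P : ℕ → Set) → (∀ r i → r < 4 → i < m → P (r + i * 4)) → ∀ x → x < m * 4 → P x
by-blocks P P-block x x<m*4 =
  subst P (sym (m≡m%n+[m/n]*n x 4)) (P-block (x % 4) (x / 4) (m%n<n x 4) (m<n*o⇒m/o<n x<m*4))

module HTG1n3 (n : ℕ) .{{_ : NonZero n}} (4≤n : 4 ≤ n) (2∣n : 2 ∣ n) where

  V : Set
  V = Vertex 1 n

  _~_ : V → V → Set
  _~_ = Adj 1 n 3

  index : V → ℕ
  index v = toℕ (proj₂ v)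

  vx : ℕ → V
  vx a = fzero , fromℕ< (m%n<n a n)

  _≈_ : ℕ → ℕ → Set
  a ≈ b = a % n ≡ b % n

  infix 4 _≈_

  Odd : ℕ → Set
  Odd a = a % 2 ≡ 1

  index-vx : ∀ a → index (vx a) ≡ a % n
  index-vx a = toℕ-fromℕ< (m%n<n a n)

  vx-cong : ∀ {a b} → a ≈ b → vx a ≡ vx b
  vx-cong {a} {b} a≈b = cong (fzero ,_) (toℕ-injective (trans (index-vx a) (trans a≈b (sym (index-vx b)))))

  vx-≈ : ∀ {a b} → vx a ≡ vx b → a ≈ b
  vx-≈ {a} {b} eq = trans (sym (index-vx a)) (trans (cong index eq) (index-vx b))

  vx-+n : ∀ a → vx (a + n) ≡ vx a
  vx-+n a = vx-cong ([m+n]%n≡m%n a n)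

  vx-index : ∀ v → vx (index v) ≡ v
  vx-index (fzero , j) = cong (fzero ,_) (toℕ-injective (trans (index-vx (toℕ j)) (m<n⇒m%n≡m (toℕ<n j))))

  index≈⇒≡vx : ∀ {w c} → index w ≈ c → w ≡ vx c
  index≈⇒≡vx {w} w≈c = trans (sym (vx-index w)) (vx-cong w≈c)

  %≈ : ∀ a → a % n ≈ a
  %≈ a = m%n%n≡m%n a n

  +n≈ : ∀ a → a + n ≈ a
  +n≈ a = [m+n]%n≡m%n a n

  %+≈ : ∀ a d → a % n + d ≈ a + d
  %+≈ a d = begin
    (a % n + d) % n          ≡⟨ %-distribˡ-+ (a % n) d n ⟩
    (a % n % n + d % n) % n  ≡⟨ cong (λ t → (t + d % n) % n) (%≈ a) ⟩
    (a % n + d % n) % n      ≡⟨ %-distribˡ-+ a d n ⟨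
    (a + d) % n              ∎
    where open ≡-Reasoning

  ≈-+ʳ : ∀ {a b} d → a ≈ b → a + d ≈ b + d
  ≈-+ʳ {a} {b} d a≈b = trans (sym (%+≈ a d)) (trans (cong (λ t → (t + d) % n) a≈b) (%+≈ b d))

  ≈-+ˡ : ∀ {a b} c → a ≈ b → c + a ≈ c + b
  ≈-+ˡ {a} {b} c a≈b = subst₂ _≈_ (+-comm a c) (+-comm b c) (≈-+ʳ c a≈b)

  ≈-cancelʳ : ∀ {a b} d → a + d ≈ b + d → a ≈ b
  ≈-cancelʳ {a} {b} d a+d≈b+d with %≡⇒CongMod a+d≈b+d
  ... | k , inj₁ eq = CongMod⇒%≡ (k , inj₁ (+-cancelʳ-≡ d a (b + k * n) (trans eq (+-right-comm b d (k * n)))))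
  ... | k , inj₂ eq = CongMod⇒%≡ (k , inj₂ (+-cancelʳ-≡ d b (a + k * n) (trans eq (+-right-comm a d (k * n)))))

  odd-suc : ∀ {a} → 2 ∣ a → Odd (suc a)
  odd-suc 2∣a = %-remove-+ʳ 1 2∣a

  ≈-cancelˡ : ∀ {a b} d → d + a ≈ d + b → a ≈ b
  ≈-cancelˡ {a} {b} d = ≈-cancelʳ d ∘ subst₂ _≈_ (+-comm d a) (+-comm d b)

  ≉+ : ∀ {a d} → 0 < d → d < n → ¬ a ≈ a + d
  ≉+ {a} {d} 0<d d<n a≈a+d with %≡⇒CongMod a≈a+d
  ... | k , inj₁ eq = <⇒≱ (m<m+n a 0<d) (≤-trans (m≤m+n (a + d) (k * n)) (≤-reflexive (sym eq)))
  ... | zero , inj₂ eq = <-irrefl (sym (+-cancelˡ-≡ a d 0 eq)) 0<d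
  ... | suc k , inj₂ eq = <⇒≱ d<n (≤-trans (m≤m+n n (k * n)) (≤-reflexive (+-cancelˡ-≡ a _ d (sym eq))))

  ≈-parity : ∀ {a b} → a ≈ b → a % 2 ≡ b % 2
  ≈-parity {a} {b} a≈b =
    trans (sym (m∣n⇒o%n%m≡o%m 2 n a 2∣n)) (trans (cong (_% 2) a≈b) (m∣n⇒o%n%m≡o%m 2 n b 2∣n))

  ≈⇒CongMod : ∀ {a c} d → c ≈ a + d → CongMod n (index (vx c)) (index (vx a) + d)
  ≈⇒CongMod {a} {c} d c≈a+d rewrite index-vx a | index-vx c =
    %≡⇒CongMod (trans (%≈ c) (trans c≈a+d (sym (%+≈ a d))))

  CongMod⇒≈ : ∀ {a c} d → CongMod n (index (vx c)) (index (vx a) + d) → c ≈ a + d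
  CongMod⇒≈ {a} {c} d cm rewrite index-vx a | index-vx c =
    trans (sym (%≈ c)) (trans (CongMod⇒%≡ cm) (%+≈ a d))

  Odd⇒CongMod : ∀ {a} → Odd a → CongMod 2 (index (vx a)) 1
  Odd⇒CongMod {a} odd rewrite index-vx a = %≡⇒CongMod (trans (m∣n⇒o%n%m≡o%m 2 n a 2∣n) odd)

  CongMod⇒Odd : ∀ {a} → CongMod 2 (index (vx a)) 1 → Odd a
  CongMod⇒Odd {a} cm rewrite index-vx a = trans (sym (m∣n⇒o%n%m≡o%m 2 n a 2∣n)) (CongMod⇒%≡ cm)

  infix 4 _⌢_

  -- A record rather than a definition, so that a and b can be inferred from a ⌢ b.
  record _⌢_ (a b : ℕ) : Set where
    constructor edge
    field ~-edge : vx a ~ vx b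

  open _⌢_ public

  ⌢-+n : ∀ {a} b → a ⌢ b + n → a ⌢ b
  ⌢-+n {a} b (edge e) = edge (subst (vx a ~_) (vx-+n b) e)

  ⌢-resp-≈ : ∀ {a a′ b b′} → a ≈ a′ → b ≈ b′ → a ⌢ b → a′ ⌢ b′
  ⌢-resp-≈ a≈a′ b≈b′ (edge e) = edge (subst₂ _~_ (vx-cong a≈a′) (vx-cong b≈b′) e)

  ⌢-sym : ∀ {a b} → a ⌢ b → b ⌢ a
  ⌢-sym (edge e) = edge (Adj-sym e)

  vx≢vx-suc : ∀ a → ¬ vx a ≡ vx (suc a)
  vx≢vx-suc a eq = ≉+ {a} {1} (s≤s z≤n) (≤-trans (s≤s (s≤s z≤n)) 4≤n) (trans (vx-≈ eq) (cong (_% n) (+-comm 1 a)))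

  ⌢-suc : ∀ a → a ⌢ suc a
  ⌢-suc a = edge (vx≢vx-suc a , inj₁ (inj₁ (refl , ≈⇒CongMod 1 (cong (_% n) (+-comm 1 a)))))

  ⌢-jump : ∀ a → Odd a → a ⌢ 3 + a
  ⌢-jump a odd = edge ((λ eq → ≉+ {a} {3} (s≤s z≤n) 4≤n (trans (vx-≈ eq) (cong (_% n) (+-comm 3 a)))) ,
                 inj₁ (inj₂ (inj₂ (refl , refl , Odd⇒CongMod odd , ≈⇒CongMod 3 (cong (_% n) (+-comm 3 a))))))

  ⌢-cases : ∀ {a c} → a ⌢ c → c ≈ suc a ⊎ a ≈ suc c ⊎ (Odd a × c ≈ 3 + a) ⊎ (Odd c × a ≈ 3 + c)
  ⌢-cases {a} (edge (_ , inj₁ (inj₁ (_ , cm))))                 = inj₁ (trans (CongMod⇒≈ 1 cm) (cong (_% n) (+-comm a 1)))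
  ⌢-cases     (edge (_ , inj₁ (inj₂ (inj₁ (() , _)))))
  ⌢-cases {a} (edge (_ , inj₁ (inj₂ (inj₂ (_ , _ , odd , cm))))) = inj₂ (inj₂ (inj₁ (CongMod⇒Odd odd , trans (CongMod⇒≈ 3 cm) (cong (_% n) (+-comm a 3)))))
  ⌢-cases {c = c} (edge (_ , inj₂ (inj₁ (_ , cm))))        = inj₂ (inj₁ (trans (CongMod⇒≈ 1 cm) (cong (_% n) (+-comm c 1))))
  ⌢-cases     (edge (_ , inj₂ (inj₂ (inj₁ (() , _)))))
  ⌢-cases {c = c} (edge (_ , inj₂ (inj₂ (inj₂ (_ , _ , odd , cm))))) = inj₂ (inj₂ (inj₂ (CongMod⇒Odd odd , trans (CongMod⇒≈ 3 cm) (cong (_% n) (+-comm c 3)))))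

  vx~⇒⌢ : ∀ {a w} → vx a ~ w → a ⌢ index w
  vx~⇒⌢ {a} {w} = edge ∘ subst (vx a ~_) (sym (vx-index w))

  ~⇒⌢ : ∀ {u v} → u ~ v → index u ⌢ index v
  ~⇒⌢ {u} {v} = edge ∘ subst₂ _~_ (sym (vx-index u)) (sym (vx-index v))

  ⌢-shift : ∀ {a c d} → 2 ∣ d → a ⌢ c → a + d ⌢ c + d
  ⌢-shift {a} {c} {d} 2∣d ac with ⌢-cases ac
  ... | inj₁ c≈1+a                = ⌢-resp-≈ refl (sym (≈-+ʳ d c≈1+a)) (⌢-suc (a + d))
  ... | inj₂ (inj₁ a≈1+c)         = ⌢-sym (⌢-resp-≈ refl (sym (≈-+ʳ d a≈1+c)) (⌢-suc (c + d)))
  ... | inj₂ (inj₂ (inj₁ (odd , c≈3+a))) =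
    ⌢-resp-≈ refl (sym (≈-+ʳ d c≈3+a)) (⌢-jump (a + d) (trans (%-remove-+ʳ a 2∣d) odd))
  ... | inj₂ (inj₂ (inj₂ (odd , a≈3+c))) =
    ⌢-sym (⌢-resp-≈ refl (sym (≈-+ʳ d a≈3+c)) (⌢-jump (c + d) (trans (%-remove-+ʳ c 2∣d) odd)))

  shift : ℕ → V → V
  shift d v = vx (index v + d)

  shift-vx : ∀ d a → shift d (vx a) ≡ vx (a + d)
  shift-vx d a = vx-cong (trans (cong (λ t → (t + d) % n) (index-vx a)) (%+≈ a d))

  shift-shift : ∀ {d e} → d + e ≈ 0 → ∀ v → shift e (shift d v) ≡ v
  shift-shift {d} {e} d+e≈0 v = begin
    shift e (shift d v)    ≡⟨ shift-vx e (index v + d) ⟩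
    vx (index v + d + e)   ≡⟨ vx-cong (trans (cong (_% n) (+-assoc (index v) d e)) (≈-+ˡ (index v) d+e≈0)) ⟩
    vx (index v + 0)       ≡⟨ cong vx (+-identityʳ (index v)) ⟩
    vx (index v)           ≡⟨ vx-index v ⟩
    v                      ∎
    where open ≡-Reasoning

  ~-shift : ∀ {d} → 2 ∣ d → ∀ {u v} → u ~ v → shift d u ~ shift d v
  ~-shift 2∣d uv = ~-edge (⌢-shift 2∣d (~⇒⌢ uv))

  opposite : ℕ → ℕ
  opposite d = pred n * d

  +-opposite : ∀ d → d + opposite d ≈ 0
  +-opposite d = trans (cong (_% n) (trans (cong (_* d) (suc-pred n)) (*-comm n d))) ([m+kn]%n≡m%n 0 d n)

  separated-shift : ∀ {d u v} → 2 ∣ d → Separated _~_ u v → Separated _~_ (shift d u) (shift d v)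
  separated-shift {d} 2∣d = separated-image (shift d) (shift (opposite d)) (~-shift 2∣d)
    (shift-shift (+-opposite d)) (shift-shift (subst (_≈ 0) (+-comm d (opposite d)) (+-opposite d)))

  SeparatedFrom : V → Set
  SeparatedFrom u = ∀ v → ¬ u ≡ v → Separated _~_ u v

  separatedFrom-shift : ∀ {t} d → 2 ∣ d → SeparatedFrom (vx t) → SeparatedFrom (vx (t + d))
  separatedFrom-shift {t} d 2∣d sep v t+d≢v =
    subst₂ (Separated _~_) (shift-vx d t) (shift-shift e+d≈0 v) (separated-shift 2∣d (sep (shift e v) t≢w))
    where
    e = opposite d
    e+d≈0 : e + d ≈ 0
    e+d≈0 = subst (_≈ 0) (+-comm d e) (+-opposite d)
    t≢w : ¬ vx t ≡ shift e v
    t≢w t≡w = t+d≢v (trans (sym (shift-vx d t)) (trans (cong (shift d) t≡w) (shift-shift e+d≈0 v)))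

  isTwoCycleFactor-vx : ∀ {L₁ L₂} → IsCycle _⌢_ L₁ → IsCycle _⌢_ L₂ →
    (∀ {x} → x ∈ L₁ ⊎ x ∈ L₂ → x < n) → (∀ x → ¬ (x ∈ L₁ × x ∈ L₂)) → (∀ x → x < n → x ∈ L₁ ⊎ x ∈ L₂) →
    IsTwoCycleFactor _~_ (map vx L₁) (map vx L₂)
  isTwoCycleFactor-vx {L₁} {L₂} cyc₁ cyc₂ bound disj cover =
    isTwoCycleFactor-map vx ~-edge cyc₁ cyc₂ injective disj (λ v → index v , vx-index v , cover (index v) (toℕ<n (proj₂ v)))
    where
    injective : ∀ {x y} → x ∈ L₁ ⊎ x ∈ L₂ → y ∈ L₁ ⊎ y ∈ L₂ → vx x ≡ vx y → x ≡ y
    injective x∈ y∈ vx≡vy = trans (sym (m<n⇒m%n≡m (bound x∈))) (trans (vx-≈ vx≡vy) (m<n⇒m%n≡m (bound y∈)))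

  neighbours-odd : ∀ {a} → 2 ∣ a → ∀ w → vx (suc a) ~ w → w ≡ vx (2 + a) ⊎ w ≡ vx a ⊎ w ≡ vx (4 + a)
  neighbours-odd {a} 2∣a w a~w with ⌢-cases (vx~⇒⌢ a~w)
  ... | inj₁ w≈2+a                    = inj₁ (index≈⇒≡vx w≈2+a)
  ... | inj₂ (inj₁ 1+a≈1+w)            = inj₂ (inj₁ (index≈⇒≡vx (sym (≈-cancelˡ 1 1+a≈1+w))))
  ... | inj₂ (inj₂ (inj₁ (_ , w≈4+a))) = inj₂ (inj₂ (index≈⇒≡vx w≈4+a))
  ... | inj₂ (inj₂ (inj₂ (odd , 1+a≈3+w))) =
    ⊥-elim (0≢1+n (trans (sym (trans (%-distribˡ-+ 3 (index w) 2) (cong (λ t → (1 + t) % 2) odd)))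
                         (trans (sym (≈-parity 1+a≈3+w)) (odd-suc 2∣a))))

  neighbours-even : ∀ {a} → 2 ∣ suc a → ∀ w → vx (suc a) ~ w → w ≡ vx a ⊎ w ≡ vx (2 + a) ⊎ w ≡ vx (a + (n ∸ 2))
  neighbours-even {a} 2∣1+a w a~w with ⌢-cases (vx~⇒⌢ a~w)
  ... | inj₁ w≈2+a                  = inj₂ (inj₁ (index≈⇒≡vx w≈2+a))
  ... | inj₂ (inj₁ 1+a≈1+w)          = inj₁ (index≈⇒≡vx (sym (≈-cancelˡ 1 1+a≈1+w)))
  ... | inj₂ (inj₂ (inj₁ (odd , _))) = ⊥-elim (0≢1+n (trans (sym (n∣m⇒m%n≡0 (suc a) 2 2∣1+a)) odd))
  ... | inj₂ (inj₂ (inj₂ (_ , 1+a≈3+w))) = inj₂ (inj₂ (index≈⇒≡vx (≈-cancelˡ 3 (trans (sym 1+a≈3+w) (sym 3+a+[n∸2]≈1+a)))))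
    where
    3+a+[n∸2]≈1+a : 3 + (a + (n ∸ 2)) ≈ suc a
    3+a+[n∸2]≈1+a = begin
      (3 + (a + (n ∸ 2))) % n     ≡⟨ cong (_% n) (lemma a (n ∸ 2)) ⟩
      (suc a + (n ∸ 2 + 2)) % n   ≡⟨ cong (λ t → (suc a + t) % n) (m∸n+n≡m (≤-trans (s≤s (s≤s z≤n)) 4≤n)) ⟩
      (suc a + n) % n             ≡⟨ +n≈ (suc a) ⟩
      suc a % n                   ∎
      where
      open ≡-Reasoning
      lemma : ∀ a x → 3 + (a + x) ≡ suc a + (x + 2)
      lemma = solve-∀

  even-block : ∀ {c} i → 2 ∣ c → 2 ∣ c + i * 4
  even-block i 2∣c = ∣m∣n⇒∣m+n 2∣c (∣n⇒∣m*n i (divides 2 refl))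

  rail-chainTo : ∀ {c f} → 2 ∣ c → ∀ j k → suc (c + (j + k) * 4) ⌢ f →
                 ChainTo _⌢_ f (c + j * 4) (suc (c + j * 4) ∷ rail c (suc j) k)
  rail-chainTo {c} {f} 2∣c j zero    last⌢f = ⌢-suc _ , subst (λ t → suc (c + t * 4) ⌢ f) (+-identityʳ j) last⌢f
  rail-chainTo {c} {f} 2∣c j (suc k) last⌢f =
    ⌢-suc _ ,
    subst (suc (c + j * 4) ⌢_) (rail-next c j) (⌢-jump _ (odd-suc (even-block j 2∣c))) ,
    rail-chainTo 2∣c (suc j) k (subst (λ t → suc (c + t * 4) ⌢ f) (+-suc j k) last⌢f)

  descent-chainTo : ∀ {f} i → 3 ⌢ f → ChainTo _⌢_ f (6 + i * 4) (descent i)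
  descent-chainTo zero    3⌢f = ⌢-sym (⌢-jump 3 refl) , 3⌢f
  descent-chainTo (suc i) 3⌢f =
    ⌢-sym (⌢-jump _ (odd-suc (even-block (suc i) (divides 1 refl)))) , ⌢-sym (⌢-suc _) , descent-chainTo i 3⌢f

module _ where
  open HTG1n3 4 ≤-refl (divides 2 refl)
  open Cycles _~_ Adj-sym

  four-not-twoSpanningCyclable : ¬ TwoSpanningCyclable 1 4 3
  four-not-twoSpanningCyclable tsc with tsc (vx 1) (vx 2) (λ ())
  ... | C₁ , C₂ , (cyc₁ , _ , disj , _) , 1∈ , 2∈ =
    proj₂ (proj₂ (cycle-forced cyc₁ 1∈ (neighbours-odd (divides 0 refl)) (λ 2∈₁ → disj _ (2∈₁ , 2∈)))) refl

module _ (r : ℕ) where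
  open HTG1n3 ((3 + r * 2) * 2) (s≤s (s≤s (s≤s (s≤s z≤n)))) (divides (3 + r * 2) refl)
  open Cycles _~_ Adj-sym

  Split : List V → List V → ℕ → Set
  Split C C′ k = vx (1 + k * 2) ∈ C × vx (2 + k * 2) ∈ C′

  split-suc : ∀ {C C′ k} → IsCycle _~_ C → IsCycle _~_ C′ → (∀ v → ¬ (v ∈ C × v ∈ C′)) →
              Split C C′ k → Split C′ C (suc k)
  split-suc {k = k} cyc cyc′ disj (odd∈ , even∈) =
    proj₁ (cycle-forced cyc′ even∈ (neighbours-even (divides (suc k) refl)) (λ odd∈′ → disj _ (odd∈ , odd∈′))) ,
    proj₁ (proj₂ (cycle-forced cyc odd∈ (neighbours-odd (divides k refl)) (λ even∈′ → disj _ (even∈′ , even∈))))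

  twiceOdd-not-twoSpanningCyclable : ¬ TwoSpanningCyclable 1 ((3 + r * 2) * 2) 3
  twiceOdd-not-twoSpanningCyclable tsc with tsc (vx 1) (vx 2) (vx≢vx-suc 1)
  ... | C₁ , C₂ , (cyc₁ , cyc₂ , disj , _) , 1∈ , 2∈ =
    disj (vx 1) (1∈ , subst (_∈ C₂) (vx-+n 1) (proj₁ (split-suc {k = suc r * 2} cyc₁ cyc₂ disj (split-even (suc r)))))
    where
    disj′ : ∀ v → ¬ (v ∈ C₂ × v ∈ C₁)
    disj′ v (v∈₂ , v∈₁) = disj v (v∈₁ , v∈₂)
    split-even : ∀ j → Split C₁ C₂ (j * 2)
    split-even zero    = 1∈ , 2∈
    split-even (suc j) = split-suc {k = suc (j * 2)} cyc₂ cyc₁ disj′ (split-suc {k = j * 2} cyc₁ cyc₂ disj (split-even j))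

module _ (p : ℕ) where
  private
    n : ℕ
    n = (2 + p) * 4

  open HTG1n3 n (s≤s (s≤s (s≤s (s≤s z≤n)))) (∣n⇒∣m*n (2 + p) (divides 2 refl))

  square squareᶜ : List ℕ
  square  = 7 + p * 4 ∷ 0 ∷ 1 ∷ 2 ∷ []
  squareᶜ = rail 0 1 (suc p) ++ 6 + p * 4 ∷ descent p

  rail-isCycle : ∀ {c} → 2 ∣ c → IsCycle _⌢_ (rail c 0 (2 + p))
  rail-isCycle {c} 2∣c =
    s≤s (s≤s (s≤s z≤n)) ,
    increasing⇒unique (rail-increasing c 0 (2 + p)) ,
    rail-chainTo 2∣c 0 (suc p) (⌢-+n (c + 0) (subst (suc (c + suc p * 4) ⌢_) (wrap c p) (⌢-jump _ (odd-suc (even-block (suc p) 2∣c)))))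
    where
    wrap : ∀ c p → 3 + suc (c + suc p * 4) ≡ c + 0 + (2 + p) * 4
    wrap = solve-∀

  rails-factor : IsTwoCycleFactor _~_ (map vx (rail 0 0 (2 + p))) (map vx (rail 2 0 (2 + p)))
  rails-factor =
    isTwoCycleFactor-vx (rail-isCycle (divides 0 refl)) (rail-isCycle (divides 1 refl))
      [ rail-< 0 (2 + p) z≤n , rail-< 0 (2 + p) (s≤s (s≤s z≤n)) ]′
      (λ x (x∈₀ , x∈₂) → <⇒≱ (s≤s (rail₀-residue 0 (2 + p) x∈₀)) (rail₂-residue 0 (2 + p) x∈₂))
      (by-blocks _ cover)
    where
    cover : ∀ r i → r < 4 → i < 2 + p → r + i * 4 ∈ rail 0 0 (2 + p) ⊎ r + i * 4 ∈ rail 2 0 (2 + p)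
    cover 0 i _ i< = inj₁ (proj₁ (∈-rail⁺ 0 (2 + p) z≤n i<))
    cover 1 i _ i< = inj₁ (proj₂ (∈-rail⁺ 0 (2 + p) z≤n i<))
    cover 2 i _ i< = inj₂ (proj₁ (∈-rail⁺ 0 (2 + p) z≤n i<))
    cover 3 i _ i< = inj₂ (proj₂ (∈-rail⁺ 0 (2 + p) z≤n i<))
    cover (suc (suc (suc (suc r)))) i (s≤s (s≤s (s≤s (s≤s ())))) _

  square-isCycle : IsCycle _⌢_ square
  square-isCycle =
    s≤s (s≤s (s≤s z≤n)) ,
    ((λ ()) All.∷ (λ ()) All.∷ (λ ()) All.∷ All.[]) ∷ ((λ ()) All.∷ (λ ()) All.∷ All.[]) ∷ ((λ ()) All.∷ All.[]) ∷ All.[] ∷ [] ,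
    ⌢-+n 0 (⌢-suc (7 + p * 4)) , ⌢-suc 0 , ⌢-suc 1 ,
    ⌢-sym (⌢-+n 2 (⌢-jump (7 + p * 4) (odd-suc (even-block p (divides 3 refl)))))

  squareᶜ-isCycle : IsCycle _⌢_ squareᶜ
  squareᶜ-isCycle =
    s≤s (s≤s (subst (1 ≤_) (sym (length-++ (rail 0 2 p))) (≤-trans (s≤s z≤n) (m≤n+m _ (length (rail 0 2 p)))))) ,
    Unique.++⁺ (increasing⇒unique (rail-increasing 0 1 (suc p)))
               (decreasing⇒unique (∷-descent-decreasing p (+-monoˡ-< (p * 4) {3} {6} (s≤s (s≤s (s≤s (s≤s z≤n)))))))
               (λ (x∈ , x∈′) → <⇒≱ (s≤s (rail₀-residue 1 (suc p) x∈)) (descent∪-residue x∈′)) ,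
    chainTo-++ (5 ∷ rail 0 2 p) (descent p) (rail-chainTo (divides 0 refl) 1 p (⌢-suc (5 + p * 4))) (descent-chainTo p (⌢-suc 3))
    where
    descent∪-residue : ∀ {x} → x ∈ 6 + p * 4 ∷ descent p → 2 ≤ x % 4
    descent∪-residue (here refl) = ≤-reflexive (sym ([m+kn]%n≡m%n 6 p 4))
    descent∪-residue (there x∈) = descent-residue p x∈

  squareᶜ-bounds : ∀ {x} → x ∈ squareᶜ → 3 ≤ x × x ≤ 6 + p * 4
  squareᶜ-bounds x∈ with ∈-++⁻ (rail 0 1 (suc p)) x∈
  ... | inj₁ x∈rail with ∈-rail⁻ 1 (suc p) x∈rail
  ...   | i , 1≤i , s≤s i≤1+p , inj₁ refl =
    ≤-trans (n≤1+n 3) (block-mono-≤ {0} {0} ≤-refl 1≤i) , block-mono-≤ {0} {2} {i} {suc p} z≤n i≤1+p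
  ...   | i , 1≤i , s≤s i≤1+p , inj₂ refl =
    ≤-trans (s≤s (s≤s (s≤s z≤n))) (block-mono-≤ {1} {1} ≤-refl 1≤i) , block-mono-≤ {1} {2} {i} {suc p} (s≤s z≤n) i≤1+p
  squareᶜ-bounds x∈ | inj₂ (here refl) = s≤s (s≤s (s≤s z≤n)) , ≤-refl
  squareᶜ-bounds x∈ | inj₂ (there x∈descent) with ∈-descent⁻ p x∈descent
  ... | i , inj₁ (i≤p , refl) = m≤m+n 3 (i * 4) , block-mono-≤ {3} {6} (s≤s (s≤s (s≤s z≤n))) i≤p
  ... | i , inj₂ (i<p , refl) = s≤s (s≤s (s≤s z≤n)) , block-mono-≤ {6} {6} ≤-refl (<⇒≤ i<p)

  square-factor : IsTwoCycleFactor _~_ (map vx square) (map vx squareᶜ)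
  square-factor = isTwoCycleFactor-vx square-isCycle squareᶜ-isCycle [ square-< , squareᶜ-< ]′ disjoint (by-blocks _ cover)
    where
    square-< : ∀ {x} → x ∈ square → x < n
    square-< (here refl)                         = ≤-refl
    square-< (there (here refl))                 = s≤s z≤n
    square-< (there (there (here refl)))         = s≤s (s≤s z≤n)
    square-< (there (there (there (here refl)))) = s≤s (s≤s (s≤s z≤n))
    squareᶜ-< : ∀ {x} → x ∈ squareᶜ → x < n
    squareᶜ-< x∈ = ≤-trans (s≤s (proj₂ (squareᶜ-bounds x∈))) (n≤1+n _)
    disjoint : ∀ x → ¬ (x ∈ square × x ∈ squareᶜ)
    disjoint x (here refl , x∈ᶜ)                         = <-irrefl refl (proj₂ (squareᶜ-bounds x∈ᶜ))
    disjoint x (there (here refl) , x∈ᶜ)                 with () ← proj₁ (squareᶜ-bounds x∈ᶜ)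
    disjoint x (there (there (here refl)) , x∈ᶜ)         with s≤s () ← proj₁ (squareᶜ-bounds x∈ᶜ)
    disjoint x (there (there (there (here refl))) , x∈ᶜ) with s≤s (s≤s ()) ← proj₁ (squareᶜ-bounds x∈ᶜ)
    inDescent : ∀ {x} → x ∈ descent p → x ∈ squareᶜ
    inDescent x∈ = ∈-++⁺ʳ (rail 0 1 (suc p)) (there x∈)
    cover : ∀ r i → r < 4 → i < 2 + p → r + i * 4 ∈ square ⊎ r + i * 4 ∈ squareᶜ
    cover 0 zero    _ _ = inj₁ (there (here refl))
    cover 1 zero    _ _ = inj₁ (there (there (here refl)))
    cover 2 zero    _ _ = inj₁ (there (there (there (here refl))))
    cover 3 zero    _ _ = inj₂ (inDescent (3+i*4∈descent p z≤n))
    cover 0 (suc i) _ i< = inj₂ (∈-++⁺ˡ (proj₁ (∈-rail⁺ 1 (suc p) (s≤s z≤n) i<)))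
    cover 1 (suc i) _ i< = inj₂ (∈-++⁺ˡ (proj₂ (∈-rail⁺ 1 (suc p) (s≤s z≤n) i<)))
    cover 2 (suc i) _ (s≤s (s≤s i≤p)) with m≤n⇒m<n∨m≡n i≤p
    ... | inj₁ i<p  = inj₂ (inDescent (6+i*4∈descent p i<p))
    ... | inj₂ refl = inj₂ (∈-++⁺ʳ (rail 0 1 (suc p)) (here refl))
    cover 3 (suc i) _ (s≤s (s≤s i≤p)) with m≤n⇒m<n∨m≡n i≤p
    ... | inj₁ i<p  = inj₂ (inDescent (3+i*4∈descent p i<p))
    ... | inj₂ refl = inj₁ (here refl)
    cover (suc (suc (suc (suc r)))) i (s≤s (s≤s (s≤s (s≤s ())))) _

  separated-by-rails : ∀ {t b} → t ∈ rail 0 0 (2 + p) → b ∈ rail 2 0 (2 + p) → Separated _~_ (vx t) (vx b)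
  separated-by-rails t∈ b∈ = map vx (rail 0 0 (2 + p)) , map vx (rail 2 0 (2 + p)) , rails-factor , ∈-map⁺ vx t∈ , ∈-map⁺ vx b∈

  separated-by-square : ∀ {t b} → t ∈ square → b ∈ squareᶜ → Separated _~_ (vx t) (vx b)
  separated-by-square t∈ b∈ = map vx square , map vx squareᶜ , square-factor , ∈-map⁺ vx t∈ , ∈-map⁺ vx b∈

  separated-0-1 : Separated _~_ (vx 0) (vx 1)
  separated-0-1 =
    subst₂ (Separated _~_) (trans (shift-vx d 2) (vx-+n 0)) (trans (shift-vx d 3) (vx-+n 1))
      (separated-shift (even-block p (divides 3 refl))
        (separated-by-square (there (there (there (here refl)))) (∈-++⁺ʳ (rail 0 1 (suc p)) (there (3+i*4∈descent p z≤n)))))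
    where
    d = 6 + p * 4

  below2∈square : ∀ {t} → t < 2 → t ∈ square
  below2∈square (s≤s z≤n)       = there (here refl)
  below2∈square (s≤s (s≤s z≤n)) = there (there (here refl))

  below2∈rail : ∀ {t} → t < 2 → t ∈ rail 0 0 (2 + p)
  below2∈rail (s≤s z≤n)       = here refl
  below2∈rail (s≤s (s≤s z≤n)) = there (here refl)

  separated-below2 : ∀ {t b} → t < 2 → b < 2 → ¬ vx t ≡ vx b → Separated _~_ (vx t) (vx b)
  separated-below2 (s≤s z≤n)       (s≤s z≤n)       t≢b = ⊥-elim (t≢b refl)
  separated-below2 (s≤s z≤n)       (s≤s (s≤s z≤n)) _   = separated-0-1
  separated-below2 (s≤s (s≤s z≤n)) (s≤s z≤n)       _   = separated-sym separated-0-1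
  separated-below2 (s≤s (s≤s z≤n)) (s≤s (s≤s z≤n)) t≢b = ⊥-elim (t≢b refl)

  separatedFrom-below2 : ∀ t → t < 2 → SeparatedFrom (vx t)
  separatedFrom-below2 t t<2 v t≢v with proj₂ (proj₂ (proj₂ square-factor)) v
  ... | inj₂ v∈ᶜ = map vx square , map vx squareᶜ , square-factor , ∈-map⁺ vx (below2∈square t<2) , v∈ᶜ
  ... | inj₁ (here refl)                         = separated-by-rails (below2∈rail t<2) (proj₂ (∈-rail⁺ 0 (2 + p) {suc p} z≤n ≤-refl))
  ... | inj₁ (there (here refl))                 = separated-below2 t<2 (s≤s z≤n) t≢v
  ... | inj₁ (there (there (here refl)))         = separated-below2 t<2 (s≤s (s≤s z≤n)) t≢v
  ... | inj₁ (there (there (there (here refl)))) = separated-by-rails (below2∈rail t<2) (here refl)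

  multipleOf4-twoSpanningCyclable : TwoSpanningCyclable 1 n 3
  multipleOf4-twoSpanningCyclable u =
    subst SeparatedFrom (trans (cong vx (sym (m≡m%n+[m/n]*n a 2))) (vx-index u))
      (separatedFrom-shift {a % 2} (a / 2 * 2) (divides (a / 2) refl) (separatedFrom-below2 (a % 2) (m%n<n a 2)))
    where
    a = index u

half : ∀ m → ∃[ r ] (m ≡ r * 2 ⊎ m ≡ suc (r * 2))
half zero = 0 , inj₁ refl
half (suc m) with half m
... | r , inj₁ refl = r , inj₂ refl
... | r , inj₂ refl = suc r , inj₁ refl

data EvenShape : ℕ → Set where
  shape-4    : EvenShape 4
  shape-4r+6 : ∀ r → EvenShape ((3 + r * 2) * 2)
  shape-4p+8 : ∀ p → EvenShape ((2 + p) * 4)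

evenShape : ∀ {n} → 4 ≤ n → 2 ∣ n → EvenShape n
evenShape {.(q * 2)} 4≤n (divides-refl q) = shape q 4≤n
  where
  shape : ∀ q → 4 ≤ q * 2 → EvenShape (q * 2)
  shape 0 ()
  shape 1 (s≤s (s≤s ()))
  shape 2 _ = shape-4
  shape (suc (suc (suc m))) _ with half m
  ... | r , inj₁ refl = shape-4r+6 r
  ... | r , inj₂ refl = subst EvenShape (reshape r) (shape-4p+8 r)
    where
    reshape : ∀ r → (2 + r) * 4 ≡ (3 + suc (r * 2)) * 2
    reshape = solve-∀

4∤[3+r*2]*2 : ∀ r → ¬ 4 ∣ (3 + r * 2) * 2
4∤[3+r*2]*2 r 4∣n with n∣m⇒m%n≡0 3 2 (∣m+n∣m⇒∣n (subst (2 ∣_) (+-comm 3 (r * 2)) (*-cancelʳ-∣ 2 4∣n)) (divides r refl))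
... | ()

lemma2p3 : (n : ℕ) → 4 ≤ n → 2 ∣ n →
    (TwoSpanningCyclable 1 n 3 ⇔ (4 ∣ n × 6 < n))
lemma2p3 n 4≤n 2∣n with evenShape 4≤n 2∣n
... | shape-4      = mk⇔ (⊥-elim ∘ four-not-twoSpanningCyclable) λ { (_ , s≤s (s≤s (s≤s (s≤s ())))) }
... | shape-4r+6 r = mk⇔ (⊥-elim ∘ twiceOdd-not-twoSpanningCyclable r) (⊥-elim ∘ 4∤[3+r*2]*2 r ∘ proj₁)
... | shape-4p+8 p = mk⇔ (λ _ → divides (2 + p) refl , s≤s (s≤s (s≤s (s≤s (s≤s (s≤s (s≤s z≤n)))))))
                          (λ _ → multipleOf4-twoSpanningCyclable p)
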